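{- Greedy BST satisfies the geometric access lemma: there is an absolute constant $c$ such that for every $n$, every height diagram $h:[n]\to\mathbb{N}$, every weight function $w$, and every accessed element $s\in[n]$, if $h'$ is the height diagram produced by Greedy BST, then \[|\mathrm{stair}_h(s)|\le \Phi_h-\Phi_{h'}+c\Big(1+\log_2\frac{W}{w(s)}\Big).\]
   Context: A height diagram is a function $h:[n]\to\mathbb{N}$. For $a\in[n]$, the stair $\mathrm{stair}_h(a)$ is the set of $b\in[n]$ such that the rectangle $[\min(a,b),\max(a,b)]\times[h(b),\infty)$ contains no point $(b',h(b'))$ with $b'\in[n]$, $b'\neq b$. The neighborhood $N_h(a)$ is the maximal open interval $(x,y)$ of reals (with $x,y\in\mathbb{R}\cup\{\pm\infty\}$) containing $a$ such that no element $b\in[n]\cap(x,y)$ with $b\ne a$ has $h(b)\ge h(a)$. Weights $w:[n]\to\mathbb{R}_{>0}$; for a set $S$ of reals, $w(S)=\sum_{a\in S\cap[n]}w(a)$; $W=w([n])$. The potential is $\Phi_h=\sum_{a\in[n]}\log_2 w(N_h(a))$. A (minimally self-adjusting) geometric BST algorithm, given $h$ and an accessed element $s$, may change only the heights of elements of $\mathrm{stair}_h(s)$, so that in the new diagram $h'$ every element of $\mathrm{stair}_h(s)$ has height strictly greater than every element outside $\mathrm{stair}_h(s)$; the access cost is $|\mathrm{stair}_h(s)|$. Greedy BST sets the heights of all elements of $\mathrm{stair}_h(s)$ to one common value greater than the height of every element outside $\mathrm{stair}_h(s)$ (other heights unchanged).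
   Formalization: The weights w take values in the positive rationals rather than in $\mathbb{R}_{>0}$. -}

module Defs where

open import Data.Nat as ℕ using (ℕ; zero; suc)
open import Data.Fin as Fin using (Fin; toℕ)
open import Data.Fin.Properties using (all?; _≟_)
open import Data.List using (List; []; _∷_; filter; length; foldr; map)
open import Data.List.Base using (allFin)
open import Data.Rational as ℚ using (ℚ; 0ℚ; 1ℚ; _*_; _+_)
open import Data.Product using (∃-syntax; _×_)
open import Relation.Nullary using (¬_; Dec)
open import Relation.Nullary.Decidable using (_→-dec_; ¬?)
open import Relation.Binary.PropositionalEquality using (_≡_; _≢_)

-- The ground set [n] is modelled as Fin n, ordered by toℕ.
-- A height diagram is h : Fin n → ℕ.

InStair : ∀ {n} → (Fin n → ℕ) → Fin n → Fin n → Set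
InStair h a b =
  ∀ b' → b' ≢ b → toℕ a ℕ.⊓ toℕ b ℕ.≤ toℕ b' → toℕ b' ℕ.≤ toℕ a ℕ.⊔ toℕ b →
  ¬ (h b ℕ.≤ h b')

inStair? : ∀ {n} (h : Fin n → ℕ) (a b : Fin n) → Dec (InStair h a b)
inStair? h a b = all? λ b' →
  ¬? (b' ≟ b) →-dec ((_ ℕ.≤? _) →-dec ((_ ℕ.≤? _) →-dec ¬? (h b ℕ.≤? h b')))

stair : ∀ {n} → (Fin n → ℕ) → Fin n → List (Fin n)
stair h a = filter (inStair? h a) (allFin _)

-- Elements of [n] lying in the neighbourhood N_h(a), the maximal open
-- interval around a containing no b ≠ a with h b ≥ h a.
InNbhd : ∀ {n} → (Fin n → ℕ) → Fin n → Fin n → Set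
InNbhd h a b =
  ∀ b' → b' ≢ a → toℕ a ℕ.⊓ toℕ b ℕ.≤ toℕ b' → toℕ b' ℕ.≤ toℕ a ℕ.⊔ toℕ b →
  ¬ (h a ℕ.≤ h b')

inNbhd? : ∀ {n} (h : Fin n → ℕ) (a b : Fin n) → Dec (InNbhd h a b)
inNbhd? h a b = all? λ b' →
  ¬? (b' ≟ a) →-dec ((_ ℕ.≤? _) →-dec ((_ ℕ.≤? _) →-dec ¬? (h a ℕ.≤? h b')))

sumℚ : List ℚ → ℚ
sumℚ = foldr _+_ 0ℚ

prodℚ : List ℚ → ℚ
prodℚ = foldr _*_ 1ℚ

_^ℚ_ : ℚ → ℕ → ℚ
q ^ℚ zero = 1ℚ
q ^ℚ suc k = q * (q ^ℚ k)

totalWeight : ∀ {n} → (Fin n → ℚ) → ℚ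
totalWeight {n} w = sumℚ (map w (allFin n))

nbhdWeight : ∀ {n} → (Fin n → ℕ) → (Fin n → ℚ) → Fin n → ℚ
nbhdWeight h w a = sumℚ (map w (filter (inNbhd? h a) (allFin _)))

-- 2^{Φ_h} = ∏_a w(N_h(a))
expPotential : ∀ {n} → (Fin n → ℕ) → (Fin n → ℚ) → ℚ
expPotential {n} h w = prodℚ (map (nbhdWeight h w) (allFin n))

GreedyStep : ∀ {n} → (Fin n → ℕ) → Fin n → (Fin n → ℕ) → Set
GreedyStep h s h' = ∃[ M ]
  ((∀ b → InStair h s b → h' b ≡ M) ×
   (∀ b → ¬ InStair h s b → h' b ≡ h b × h b ℕ.< M))

twoℚ : ℚ
twoℚ = 1ℚ + 1ℚ

{-# OPTIONS --safe #-}
module Submission where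

-- After a Greedy step every stair element has the same, maximal height, so the new
-- neighbourhood N′(x) of a stair element x lies strictly between its two neighbours on the
-- stair, while N′(x) ⊆ N(x) for every x off the stair.  Let x₁ < … < x_k be the stair elements
-- left of s, x_{k+1} = s, and u_i = w[x_i, s], with u₀ = w[0, s].  The old neighbourhood of x_i
-- contains [x_i, s], and N′(x_i) and [x_{i+1}, s] are disjoint subsets of [x_{i-1}, s], so
-- 2 w(N′(x_i)) u_{i+1} ≤ u_{i-1}², hence 2 w(N′(x_i)) u_{i+1} u_i² ≤ w(N(x_i)) u_i u_{i-1}².
-- Multiplied over i this telescopes to a factor at most (W / w(s))³.  The right side of s is
-- symmetric and s itself costs 2W / w(s), so the bound holds with c = 7.  Everything is kept
-- multiplicative, since 2^Φ is the product of the neighbourhood weights.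

open import Defs
open import Algebra.Bundles using (CommutativeMonoid)
open import Data.Empty using (⊥-elim)
open import Data.Fin as Fin using (Fin; toℕ)
open import Data.Fin.Properties using (toℕ-injective; toℕ<n; <⇒≢)
open import Data.List using (List; []; _∷_; _++_; filter; map; length; allFin)
open import Data.List.Membership.Propositional using (_∈_)
open import Data.List.Membership.Propositional.Properties using (∈-filter⁺; ∈-allFin; ∈-∃++)
open import Data.List.Relation.Unary.All as All using (All; []; _∷_)
import Data.List.Relation.Unary.All.Properties as Allₚ
open import Data.List.Relation.Unary.AllPairs as AllPairs using (AllPairs; []; _∷_)
import Data.List.Relation.Unary.AllPairs.Properties as AllPairsₚ
open import Data.List.Relation.Unary.Any using (here; there)
open import Data.Maybe using (nothing)
open import Data.Nat as ℕ using (ℕ; suc; _⊓_; _⊔_)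
import Data.Nat.Properties as ℕₚ
open import Data.Product using (∃-syntax; _×_; _,_; proj₁; proj₂)
open import Data.Rational as ℚ using (ℚ; 0ℚ; 1ℚ; _+_; _*_; _≤_; _<_)
import Data.Rational.Properties as ℚₚ
open import Data.Unit using (⊤; tt)
open import Function using (id)
open import Level using (0ℓ)
open import Relation.Binary.PropositionalEquality
  using (_≡_; _≢_; refl; sym; trans; cong; cong₂; subst; subst₂; module ≡-Reasoning)
open import Relation.Nullary using (¬_; yes; no)
open import Relation.Nullary.Decidable using (_×-dec_)
open import Relation.Unary using (Pred; Decidable; _⊆_)
open import Relation.Unary.Properties using (∁?)
open import Tactic.RingSolver using (solve-∀)
open import Tactic.RingSolver.Core.AlmostCommutativeRing using (AlmostCommutativeRing; fromCommutativeRing)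
open import Algebra.Properties.CommutativeSemigroup
  (CommutativeMonoid.commutativeSemigroup ℚₚ.*-1-commutativeMonoid)
  using (interchange; x∙yz≈y∙xz; xy∙z≈y∙xz; xy∙z≈xz∙y)
open import Algebra.Properties.CommutativeSemigroup
  (CommutativeMonoid.commutativeSemigroup ℚₚ.+-0-commutativeMonoid)
  using () renaming (x∙yz≈y∙xz to x+yz≈y+xz)

ℚ-ring : AlmostCommutativeRing 0ℓ 0ℓ
ℚ-ring = fromCommutativeRing ℚₚ.+-*-commutativeRing (λ _ → nothing)

square cube : ℚ → ℚ
square p = p * p
cube p = p * square p

*-nonNeg : ∀ {p q} → 0ℚ ≤ p → 0ℚ ≤ q → 0ℚ ≤ p * q
*-nonNeg {p} {q} 0≤p 0≤q =
  ℚₚ.nonNegative⁻¹ (p * q) {{ℚₚ.nonNeg*nonNeg⇒nonNeg p {{ℚ.nonNegative 0≤p}} q {{ℚ.nonNegative 0≤q}}}}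

*-monoˡ-≤ : ∀ {p q} r → 0ℚ ≤ r → p ≤ q → r * p ≤ r * q
*-monoˡ-≤ r 0≤r = ℚₚ.*-monoˡ-≤-nonNeg r {{ℚ.nonNegative 0≤r}}

*-mono-≤ : ∀ {p q r t} → 0ℚ ≤ p → 0ℚ ≤ r → p ≤ q → r ≤ t → p * r ≤ q * t
*-mono-≤ {p} {q} {r} {t} 0≤p 0≤r p≤q r≤t = begin
  p * r ≤⟨ ℚₚ.*-monoʳ-≤-nonNeg r {{ℚ.nonNegative 0≤r}} p≤q ⟩
  q * r ≤⟨ *-monoˡ-≤ q (ℚₚ.≤-trans 0≤p p≤q) r≤t ⟩
  q * t ∎
  where open ℚₚ.≤-Reasoning

square-mono-≤ : ∀ {p q} → 0ℚ ≤ p → p ≤ q → square p ≤ square q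
square-mono-≤ 0≤p p≤q = *-mono-≤ 0≤p 0≤p p≤q p≤q

0≤1 : 0ℚ ≤ 1ℚ
0≤1 = ℚₚ.<⇒≤ (ℚₚ.positive⁻¹ 1ℚ)

0≤2 : 0ℚ ≤ twoℚ
0≤2 = ℚₚ.<⇒≤ (ℚₚ.positive⁻¹ twoℚ)

^ℚ-nonNeg : ∀ {p} → 0ℚ ≤ p → ∀ k → 0ℚ ≤ p ^ℚ k
^ℚ-nonNeg 0≤p ℕ.zero = 0≤1
^ℚ-nonNeg 0≤p (suc k) = *-nonNeg 0≤p (^ℚ-nonNeg 0≤p k)

p≤q+p : ∀ {p q} → 0ℚ ≤ q → p ≤ q + p
p≤q+p {p} 0≤q = ℚₚ.≤-trans (ℚₚ.≤-reflexive (sym (ℚₚ.+-identityˡ p))) (ℚₚ.+-monoˡ-≤ p 0≤q)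

p≤2p : ∀ {p} → 0ℚ ≤ p → p ≤ twoℚ * p
p≤2p {p} 0≤p = ℚₚ.≤-trans (p≤q+p 0≤p) (ℚₚ.≤-reflexive (p+p≡2p p))
  where
  p+p≡2p : ∀ p → p + p ≡ twoℚ * p
  p+p≡2p = solve-∀ ℚ-ring

twice-product-≤-square : ∀ {p q r} → 0ℚ ≤ p → 0ℚ ≤ q → p + q ≤ r → (twoℚ * p) * q ≤ square r
twice-product-≤-square {p} {q} {r} 0≤p 0≤q p+q≤r = begin
  (twoℚ * p) * q                    ≤⟨ p≤q+p (ℚₚ.+-mono-≤ (*-nonNeg 0≤p 0≤p) (*-nonNeg 0≤q 0≤q)) ⟩
  (p * p + q * q) + (twoℚ * p) * q  ≡⟨ square-of-sum p q ⟩
  square (p + q)                    ≤⟨ square-mono-≤ (ℚₚ.+-mono-≤ 0≤p 0≤q) p+q≤r ⟩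
  square r                          ∎
  where
  open ℚₚ.≤-Reasoning
  square-of-sum : ∀ p q → (p * p + q * q) + (twoℚ * p) * q ≡ (p + q) * (p + q)
  square-of-sum = solve-∀ ℚ-ring

link-≤ : ∀ {b x y z a} → 0ℚ ≤ b → 0ℚ ≤ x → 0ℚ ≤ y → b + x ≤ z → y ≤ a →
  (twoℚ * b) * (x * square y) ≤ a * (y * square z)
link-≤ {b} {x} {y} {z} {a} 0≤b 0≤x 0≤y b+x≤z y≤a = begin
  (twoℚ * b) * (x * square y)  ≡⟨ ℚₚ.*-assoc (twoℚ * b) x (square y) ⟨
  ((twoℚ * b) * x) * square y  ≤⟨ *-mono-≤ (*-nonNeg (*-nonNeg 0≤2 0≤b) 0≤x) (*-nonNeg 0≤y 0≤y)
                                    (twice-product-≤-square 0≤b 0≤x b+x≤z) ℚₚ.≤-refl ⟩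
  square z * square y          ≡⟨ ℚₚ.*-comm (square z) (square y) ⟩
  (y * y) * square z           ≡⟨ ℚₚ.*-assoc y y (square z) ⟩
  y * (y * square z)           ≤⟨ ℚₚ.*-monoʳ-≤-nonNeg (y * square z) {{ℚ.nonNegative 0≤y*z²}} y≤a ⟩
  a * (y * square z)           ∎
  where
  open ℚₚ.≤-Reasoning
  0≤z = ℚₚ.≤-trans (ℚₚ.+-mono-≤ 0≤b 0≤x) b+x≤z
  0≤y*z² = *-nonNeg 0≤y (*-nonNeg 0≤z 0≤z)

*-telescope-≤ : ∀ {c₁ a₁ c₂ a₂ r r′ q} → 0ℚ ≤ c₂ → 0ℚ ≤ a₁ →
  c₁ * r ≤ a₁ * r′ → c₂ * r′ ≤ a₂ * q → (c₁ * c₂) * r ≤ (a₁ * a₂) * q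
*-telescope-≤ {c₁} {a₁} {c₂} {a₂} {r} {r′} {q} 0≤c₂ 0≤a₁ first second = begin
  (c₁ * c₂) * r   ≡⟨ xy∙z≈y∙xz c₁ c₂ r ⟩
  c₂ * (c₁ * r)   ≤⟨ *-monoˡ-≤ c₂ 0≤c₂ first ⟩
  c₂ * (a₁ * r′)  ≡⟨ x∙yz≈y∙xz c₂ a₁ r′ ⟩
  a₁ * (c₂ * r′)  ≤⟨ *-monoˡ-≤ a₁ 0≤a₁ second ⟩
  a₁ * (a₂ * q)   ≡⟨ ℚₚ.*-assoc a₁ a₂ q ⟨
  (a₁ * a₂) * q   ∎
  where open ℚₚ.≤-Reasoning

-- Finite sums and products

module WeightedSums {A : Set} (w : A → ℚ) (w≥0 : ∀ x → 0ℚ ≤ w x) where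

  weight : {P : Pred A 0ℓ} → Decidable P → List A → ℚ
  weight P? xs = sumℚ (map w (filter P? xs))

  weight-nonNeg : ∀ {P} (P? : Decidable P) xs → 0ℚ ≤ weight P? xs
  weight-nonNeg P? [] = ℚₚ.≤-refl
  weight-nonNeg P? (x ∷ xs) with P? x
  ... | yes _ = ℚₚ.+-mono-≤ (w≥0 x) (weight-nonNeg P? xs)
  ... | no _  = weight-nonNeg P? xs

  weight-mono : ∀ {P R} (P? : Decidable P) (R? : Decidable R) → P ⊆ R →
    ∀ xs → weight P? xs ≤ weight R? xs
  weight-mono P? R? P⊆R [] = ℚₚ.≤-refl
  weight-mono P? R? P⊆R (x ∷ xs) with ih ← weight-mono P? R? P⊆R xs | P? x | R? x
  ... | yes p | no ¬r = ⊥-elim (¬r (P⊆R p))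
  ... | yes _ | yes _ = ℚₚ.+-monoʳ-≤ (w x) ih
  ... | no _  | no _  = ih
  ... | no _  | yes _ = ℚₚ.≤-trans ih (p≤q+p (w≥0 x))

  weight-disjoint-≤ : ∀ {P Q R} (P? : Decidable P) (Q? : Decidable Q) (R? : Decidable R) →
    P ⊆ R → Q ⊆ R → (∀ {x} → P x → ¬ Q x) →
    ∀ xs → weight P? xs + weight Q? xs ≤ weight R? xs
  weight-disjoint-≤ P? Q? R? P⊆R Q⊆R P∩Q=∅ [] = ℚₚ.≤-refl
  weight-disjoint-≤ P? Q? R? P⊆R Q⊆R P∩Q=∅ (x ∷ xs)
    with ih ← weight-disjoint-≤ P? Q? R? P⊆R Q⊆R P∩Q=∅ xs | P? x | Q? x | R? x
  ... | yes p | yes q | _     = ⊥-elim (P∩Q=∅ p q)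
  ... | yes p | no _  | no ¬r = ⊥-elim (¬r (P⊆R p))
  ... | no _  | yes q | no ¬r = ⊥-elim (¬r (Q⊆R q))
  ... | yes _ | no _  | yes _ =
    ℚₚ.≤-trans (ℚₚ.≤-reflexive (ℚₚ.+-assoc (w x) (weight P? xs) (weight Q? xs))) (ℚₚ.+-monoʳ-≤ (w x) ih)
  ... | no _  | yes _ | yes _ =
    ℚₚ.≤-trans (ℚₚ.≤-reflexive (x+yz≈y+xz (weight P? xs) (w x) (weight Q? xs))) (ℚₚ.+-monoʳ-≤ (w x) ih)
  ... | no _  | no _  | no _  = ih
  ... | no _  | no _  | yes _ = ℚₚ.≤-trans ih (p≤q+p (w≥0 x))

  weight-∈ : ∀ {P} (P? : Decidable P) {x} xs → x ∈ xs → P x → w x ≤ weight P? xs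
  weight-∈ P? (y ∷ xs) (here refl) px with P? y
  ... | yes _  = ℚₚ.≤-trans (ℚₚ.≤-reflexive (sym (ℚₚ.+-identityʳ (w y))))
                            (ℚₚ.+-monoʳ-≤ (w y) (weight-nonNeg P? xs))
  ... | no ¬px = ⊥-elim (¬px px)
  weight-∈ P? (y ∷ xs) (there x∈xs) px with ih ← weight-∈ P? xs x∈xs px | P? y
  ... | yes _ = ℚₚ.≤-trans ih (p≤q+p (w≥0 y))
  ... | no _  = ih

  weight≤sum : ∀ {P} (P? : Decidable P) xs → weight P? xs ≤ sumℚ (map w xs)
  weight≤sum P? [] = ℚₚ.≤-refl
  weight≤sum P? (x ∷ xs) with ih ← weight≤sum P? xs | P? x
  ... | yes _ = ℚₚ.+-monoʳ-≤ (w x) ih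
  ... | no _  = ℚₚ.≤-trans ih (p≤q+p (w≥0 x))

Π : ∀ {A : Set} → (A → ℚ) → List A → ℚ
Π f xs = prodℚ (map f xs)

module _ {A : Set} where

  Π-nonNeg : ∀ {f : A → ℚ} → (∀ x → 0ℚ ≤ f x) → ∀ xs → 0ℚ ≤ Π f xs
  Π-nonNeg f≥0 [] = 0≤1
  Π-nonNeg f≥0 (x ∷ xs) = *-nonNeg (f≥0 x) (Π-nonNeg f≥0 xs)

  Π-mono : ∀ {f g : A → ℚ} → (∀ x → 0ℚ ≤ f x) → ∀ {xs} → All (λ x → f x ≤ g x) xs → Π f xs ≤ Π g xs
  Π-mono f≥0 [] = ℚₚ.≤-refl
  Π-mono f≥0 {x ∷ xs} (fx≤gx ∷ f≤g) = *-mono-≤ (f≥0 x) (Π-nonNeg f≥0 xs) fx≤gx (Π-mono f≥0 f≤g)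

  Π-++ : ∀ (f : A → ℚ) xs ys → Π f (xs ++ ys) ≡ Π f xs * Π f ys
  Π-++ f [] ys = sym (ℚₚ.*-identityˡ _)
  Π-++ f (x ∷ xs) ys = trans (cong (f x *_) (Π-++ f xs ys)) (sym (ℚₚ.*-assoc (f x) _ _))

  Π-partition : ∀ {P : Pred A 0ℓ} (P? : Decidable P) f xs →
    Π f xs ≡ Π f (filter P? xs) * Π f (filter (∁? P?) xs)
  Π-partition P? f [] = refl
  Π-partition P? f (x ∷ xs) with ih ← Π-partition P? f xs | P? x
  ... | yes _ = trans (cong (f x *_) ih) (sym (ℚₚ.*-assoc (f x) _ _))
  ... | no _  = trans (cong (f x *_) ih) (x∙yz≈y∙xz (f x) (Π f (filter P? xs)) (Π f (filter (∁? P?) xs)))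

  Π-scale : ∀ c (f : A → ℚ) xs → c ^ℚ length xs * Π f xs ≡ Π (λ x → c * f x) xs
  Π-scale c f [] = refl
  Π-scale c f (x ∷ xs) = trans (interchange c (c ^ℚ length xs) (f x) (Π f xs))
                               (cong (c * f x *_) (Π-scale c f xs))

AllPairs-++⁻ : ∀ {A : Set} {R : A → A → Set} xs {ys} → AllPairs R (xs ++ ys) →
  AllPairs R xs × All (λ x → All (R x) ys) xs × AllPairs R ys
AllPairs-++⁻ [] sorted = [] , [] , sorted
AllPairs-++⁻ (x ∷ xs) (x-R ∷ sorted) =
  let xs-sorted , xs-R-ys , ys-sorted = AllPairs-++⁻ xs sorted
  in Allₚ.++⁻ˡ xs x-R ∷ xs-sorted , Allₚ.++⁻ʳ xs x-R ∷ xs-R-ys , ys-sorted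

-- Stairs and neighbourhoods

segment-⊆ : ∀ {i j k l} → i ⊓ j ℕ.≤ k → k ℕ.≤ i ⊔ j → j ⊓ k ℕ.≤ l → l ℕ.≤ j ⊔ k →
  i ⊓ j ℕ.≤ l × l ℕ.≤ i ⊔ j
segment-⊆ {i} {j} i⊓j≤k k≤i⊔j j⊓k≤l l≤j⊔k =
  ℕₚ.≤-trans (ℕₚ.⊓-glb (ℕₚ.m⊓n≤n i j) i⊓j≤k) j⊓k≤l ,
  ℕₚ.≤-trans l≤j⊔k (ℕₚ.⊔-lub (ℕₚ.m≤n⊔m i j) k≤i⊔j)

module _ {n : ℕ} where

  segment-self : ∀ {a b : Fin n} → toℕ a ⊓ toℕ a ℕ.≤ toℕ b → toℕ b ℕ.≤ toℕ a ⊔ toℕ a → b ≡ a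
  segment-self {a} lo hi = toℕ-injective (ℕₚ.≤-antisym
    (subst (_ ℕ.≤_) (ℕₚ.⊔-idem (toℕ a)) hi) (subst (ℕ._≤ _) (ℕₚ.⊓-idem (toℕ a)) lo))

  nbhd-self : ∀ (g : Fin n → ℕ) a → InNbhd g a a
  nbhd-self g a b′ b′≢a lo hi _ = b′≢a (segment-self lo hi)

  stair-self : ∀ (g : Fin n → ℕ) a → InStair g a a
  stair-self g a b′ b′≢a lo hi _ = b′≢a (segment-self lo hi)

  stair-segment⊆nbhd : ∀ {g : Fin n → ℕ} {a x b} → InStair g a x →
    toℕ a ⊓ toℕ x ℕ.≤ toℕ b → toℕ b ℕ.≤ toℕ a ⊔ toℕ x → InNbhd g x b
  stair-segment⊆nbhd a-x lo hi b′ b′≢x lo′ hi′ =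
    let lo″ , hi″ = segment-⊆ lo hi lo′ hi′ in a-x b′ b′≢x lo″ hi″

module GreedyGeometry {n} {h h′ : Fin n → ℕ} {s : Fin n} (greedy : GreedyStep h s h′) where

  private
    M : ℕ
    M = proj₁ greedy

    raised : ∀ {b} → InStair h s b → h′ b ≡ M
    raised = proj₁ (proj₂ greedy) _

    kept : ∀ {b} → ¬ InStair h s b → h′ b ≡ h b × h b ℕ.< M
    kept = proj₂ (proj₂ greedy) _

  stair-blocks-nbhd′ : ∀ {x y b} → InStair h s x → InStair h s y → y ≢ x →
    toℕ x ⊓ toℕ b ℕ.≤ toℕ y → toℕ y ℕ.≤ toℕ x ⊔ toℕ b → ¬ InNbhd h′ x b
  stair-blocks-nbhd′ sx sy y≢x lo hi nb =
    nb _ y≢x lo hi (ℕₚ.≤-reflexive (trans (raised sx) (sym (raised sy))))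

  nbhd′-left-of-stair : ∀ {x y b} → InStair h s x → InStair h s y → x Fin.< y →
    InNbhd h′ x b → toℕ b ℕ.< toℕ y
  nbhd′-left-of-stair sx sy x<y nb = ℕₚ.≰⇒> λ y≤b →
    stair-blocks-nbhd′ sx sy (λ y≡x → <⇒≢ x<y (sym y≡x))
      (ℕₚ.≤-trans (ℕₚ.m⊓n≤m _ _) (ℕₚ.<⇒≤ x<y)) (ℕₚ.≤-trans y≤b (ℕₚ.m≤n⊔m _ _)) nb

  nbhd′-right-of-stair : ∀ {x y b} → InStair h s x → InStair h s y → y Fin.< x →
    InNbhd h′ x b → toℕ y ℕ.< toℕ b
  nbhd′-right-of-stair sx sy y<x nb = ℕₚ.≰⇒> λ b≤y →
    stair-blocks-nbhd′ sx sy (<⇒≢ y<x)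
      (ℕₚ.≤-trans (ℕₚ.m⊓n≤n _ _) b≤y) (ℕₚ.≤-trans (ℕₚ.<⇒≤ y<x) (ℕₚ.m≤m⊔n _ _)) nb

  nbhd′⊆nbhd : ∀ {a b} → ¬ InStair h s a → InNbhd h′ a b → InNbhd h a b
  nbhd′⊆nbhd {a} ¬sa nb b′ b′≢a lo hi ha≤hb′ with inStair? h s b′
  ... | yes sb′ = nb b′ b′≢a lo hi
        (subst₂ ℕ._≤_ (sym (proj₁ (kept ¬sa))) (sym (raised sb′)) (ℕₚ.<⇒≤ (proj₂ (kept ¬sa))))
  ... | no ¬sb′ = nb b′ b′≢a lo hi
        (subst₂ ℕ._≤_ (sym (proj₁ (kept ¬sa))) (sym (proj₁ (kept ¬sb′))) ha≤hb′)

-- Weights of segments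

InSegment : ∀ {n} → ℕ → ℕ → Pred (Fin n) 0ℓ
InSegment lo hi b = lo ℕ.≤ toℕ b × toℕ b ℕ.≤ hi

inSegment? : ∀ {n} lo hi → Decidable (InSegment {n} lo hi)
inSegment? lo hi b = (lo ℕ.≤? toℕ b) ×-dec (toℕ b ℕ.≤? hi)

module SegmentWeights {n} (w : Fin n → ℚ) (w≥0 : ∀ i → 0ℚ ≤ w i) where

  open WeightedSums w w≥0 public

  segment : ℕ → ℕ → ℚ
  segment lo hi = weight (inSegment? lo hi) (allFin n)

  segment-nonNeg : ∀ lo hi → 0ℚ ≤ segment lo hi
  segment-nonNeg lo hi = weight-nonNeg (inSegment? lo hi) (allFin n)

  w≤segment : ∀ {lo hi} i → lo ℕ.≤ toℕ i → toℕ i ℕ.≤ hi → w i ≤ segment lo hi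
  w≤segment {lo} {hi} i lo≤i i≤hi = weight-∈ (inSegment? lo hi) (allFin n) (∈-allFin i) (lo≤i , i≤hi)

  segment≤total : ∀ lo hi → segment lo hi ≤ totalWeight w
  segment≤total lo hi = weight≤sum (inSegment? lo hi) (allFin n)

  weight-+-segment-≤ˡ : ∀ {P} (P? : Decidable P) {lo mid hi} → lo ℕ.≤ mid →
    (∀ {b} → P b → InSegment lo hi b × toℕ b ℕ.< mid) →
    weight P? (allFin n) + segment mid hi ≤ segment lo hi
  weight-+-segment-≤ˡ P? lo≤mid P-below-mid = weight-disjoint-≤ P? (inSegment? _ _) (inSegment? _ _)
    (λ pb → proj₁ (P-below-mid pb))
    (λ (mid≤b , b≤hi) → ℕₚ.≤-trans lo≤mid mid≤b , b≤hi)
    (λ pb (mid≤b , _) → ℕₚ.<⇒≱ (proj₂ (P-below-mid pb)) mid≤b)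
    (allFin n)

  weight-+-segment-≤ʳ : ∀ {P} (P? : Decidable P) {lo mid hi} → mid ℕ.≤ hi →
    (∀ {b} → P b → InSegment lo hi b × mid ℕ.< toℕ b) →
    weight P? (allFin n) + segment lo mid ≤ segment lo hi
  weight-+-segment-≤ʳ P? mid≤hi P-above-mid = weight-disjoint-≤ P? (inSegment? _ _) (inSegment? _ _)
    (λ pb → proj₁ (P-above-mid pb))
    (λ (lo≤b , b≤mid) → lo≤b , ℕₚ.≤-trans b≤mid mid≤hi)
    (λ pb (_ , b≤mid) → ℕₚ.<⇒≱ (proj₂ (P-above-mid pb)) b≤mid)
    (allFin n)

module AccessBound {n} {h h′ : Fin n → ℕ} {s : Fin n} (greedy : GreedyStep h s h′)
                   (w : Fin n → ℚ) (w≥0 : ∀ i → 0ℚ ≤ w i) where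

  open GreedyGeometry greedy
  open SegmentWeights w w≥0

  Stair : Pred (Fin n) 0ℓ
  Stair = InStair h s

  A B C : Fin n → ℚ
  A = nbhdWeight h w
  B = nbhdWeight h′ w
  C x = twoℚ * B x

  T : ℚ
  T = twoℚ * totalWeight w

  A-nonNeg : ∀ x → 0ℚ ≤ A x
  A-nonNeg x = weight-nonNeg (inNbhd? h x) (allFin n)

  B-nonNeg : ∀ x → 0ℚ ≤ B x
  B-nonNeg x = weight-nonNeg (inNbhd? h′ x) (allFin n)

  C-nonNeg : ∀ x → 0ℚ ≤ C x
  C-nonNeg x = *-nonNeg 0≤2 (B-nonNeg x)

  segment≤T : ∀ lo hi → segment lo hi ≤ T
  segment≤T lo hi = ℚₚ.≤-trans (segment≤total lo hi)
    (p≤2p (ℚₚ.≤-trans (segment-nonNeg lo hi) (segment≤total lo hi)))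

  segments≤cube-T : ∀ lo hi lo′ hi′ → segment lo hi * square (segment lo′ hi′) ≤ cube T
  segments≤cube-T lo hi lo′ hi′ = *-mono-≤ (segment-nonNeg lo hi) (*-nonNeg 0≤seg′ 0≤seg′)
    (segment≤T lo hi) (square-mono-≤ 0≤seg′ (segment≤T lo′ hi′))
    where 0≤seg′ = segment-nonNeg lo′ hi′

  segment≤A-left : ∀ {x} → Stair x → toℕ x ℕ.≤ toℕ s → segment (toℕ x) (toℕ s) ≤ A x
  segment≤A-left sx x≤s = weight-mono (inSegment? _ _) (inNbhd? h _)
    (λ (x≤b , b≤s) → stair-segment⊆nbhd sx
      (ℕₚ.≤-trans (ℕₚ.m⊓n≤n _ _) x≤b) (ℕₚ.≤-trans b≤s (ℕₚ.m≤m⊔n _ _)))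
    (allFin n)

  segment≤A-right : ∀ {x} → Stair x → toℕ s ℕ.≤ toℕ x → segment (toℕ s) (toℕ x) ≤ A x
  segment≤A-right sx s≤x = weight-mono (inSegment? _ _) (inNbhd? h _)
    (λ (s≤b , b≤x) → stair-segment⊆nbhd sx
      (ℕₚ.≤-trans (ℕₚ.m⊓n≤m _ _) s≤b) (ℕₚ.≤-trans b≤x (ℕₚ.m≤n⊔m _ _)))
    (allFin n)

  HeadNbhd′From : ℕ → List (Fin n) → Set
  HeadNbhd′From p [] = ⊤
  HeadNbhd′From p (x ∷ _) = ∀ {b} → InNbhd h′ x b → p ℕ.≤ toℕ b

  headNbhd′From-zero : ∀ ys → HeadNbhd′From 0 ys
  headNbhd′From-zero [] = tt
  headNbhd′From-zero (_ ∷ _) _ = ℕ.z≤n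

  headNbhd′From-weaken : ∀ {p q} ys → p ℕ.≤ q → HeadNbhd′From q ys → HeadNbhd′From p ys
  headNbhd′From-weaken [] _ _ = tt
  headNbhd′From-weaken (_ ∷ _) p≤q from-q nb = ℕₚ.≤-trans p≤q (from-q nb)

  headNbhd′From-next : ∀ {x} ys → Stair x → All Stair ys → All (x Fin.<_) ys →
    HeadNbhd′From (suc (toℕ x)) ys
  headNbhd′From-next [] _ _ _ = tt
  headNbhd′From-next (y ∷ _) sx (sy ∷ _) (x<y ∷ _) = nbhd′-right-of-stair sy sx x<y

  headPos : ℕ → List (Fin n) → ℕ
  headPos d [] = d
  headPos d (y ∷ _) = toℕ y

  nbhd′-before-next : ∀ {x d} ys → Stair x → All Stair ys → All (x Fin.<_) ys →
    (∀ {b} → InNbhd h′ x b → toℕ b ℕ.< d) → ∀ {b} → InNbhd h′ x b → toℕ b ℕ.< headPos d ys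
  nbhd′-before-next [] _ _ _ before-d = before-d
  nbhd′-before-next (y ∷ _) sx (sy ∷ _) (x<y ∷ _) _ = nbhd′-left-of-stair sx sy x<y

  -- Induction from the outermost stair element towards s; p is where N′ of the current one may start.
  left-chain : ∀ xs {p} → p ℕ.≤ toℕ s → AllPairs Fin._<_ xs → All (Fin._< s) xs → All Stair xs →
    HeadNbhd′From p xs →
    Π C xs * cube (w s) ≤ Π A xs * (segment (headPos (toℕ s) xs) (toℕ s) * square (segment p (toℕ s)))
  left-chain [] p≤s _ _ _ _ = *-monoˡ-≤ 1ℚ 0≤1
    (*-mono-≤ (w≥0 s) (*-nonNeg (w≥0 s) (w≥0 s)) (w≤segment s ℕₚ.≤-refl ℕₚ.≤-refl)
      (square-mono-≤ (w≥0 s) (w≤segment s p≤s ℕₚ.≤-refl)))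
  left-chain (x ∷ ys) {p} p≤s (x<ys ∷ ys-sorted) (x<s ∷ ys<s) (sx ∷ ys-stair) from-p =
    subst₂ (λ c a → c * cube (w s) ≤ a * outer) (ℚₚ.*-comm (Π C ys) (C x)) (ℚₚ.*-comm (Π A ys) (A x))
      (*-telescope-≤ {c₁ = Π C ys} {r = cube (w s)} (C-nonNeg x) (Π-nonNeg A-nonNeg ys) inner link)
    where
    outer = segment (toℕ x) (toℕ s) * square (segment p (toℕ s))
    before-s : ∀ {b} → InNbhd h′ x b → toℕ b ℕ.< toℕ s
    before-s = nbhd′-left-of-stair sx (stair-self h s) x<s
    before-next : ∀ {b} → InNbhd h′ x b → toℕ b ℕ.< headPos (toℕ s) ys
    before-next = nbhd′-before-next ys sx ys-stair x<ys before-s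
    inner = left-chain ys (ℕₚ.<⇒≤ x<s) ys-sorted ys<s ys-stair
      (headNbhd′From-weaken ys (ℕₚ.n≤1+n _) (headNbhd′From-next ys sx ys-stair x<ys))
    link : C x * (segment (headPos (toℕ s) ys) (toℕ s) * square (segment (toℕ x) (toℕ s))) ≤ A x * outer
    link = link-≤ (B-nonNeg x) (segment-nonNeg _ _) (segment-nonNeg _ _)
      (weight-+-segment-≤ˡ (inNbhd? h′ x)
        (ℕₚ.≤-trans (from-p (nbhd-self h′ x)) (ℕₚ.<⇒≤ (before-next (nbhd-self h′ x))))
        (λ nb → (from-p nb , ℕₚ.<⇒≤ (before-s nb)) , before-next nb))
      (segment≤A-left sx (ℕₚ.<⇒≤ x<s))

  -- Induction from s outwards; q is the previous stair element (initially s), which N′ of the current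
  -- one lies beyond.
  right-chain : ∀ xs {q} → toℕ s ℕ.≤ q → AllPairs Fin._<_ xs → All Stair xs → HeadNbhd′From (suc q) xs →
    Π C xs * (segment (toℕ s) q * square (segment (toℕ s) (headPos n xs))) ≤ Π A xs * cube T
  right-chain [] _ _ _ _ = *-monoˡ-≤ 1ℚ 0≤1 (segments≤cube-T _ _ _ _)
  right-chain (x ∷ ys) {q} s≤q (x<ys ∷ ys-sorted) (sx ∷ ys-stair) after-q =
    *-telescope-≤ {c₁ = C x} {r = segment (toℕ s) q * square (segment (toℕ s) (toℕ x))}
      (Π-nonNeg C-nonNeg ys) (A-nonNeg x) link
      (right-chain ys s≤x ys-sorted ys-stair (headNbhd′From-next ys sx ys-stair x<ys))
    where
    before-next : ∀ {b} → InNbhd h′ x b → toℕ b ℕ.< headPos n ys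
    before-next = nbhd′-before-next ys sx ys-stair x<ys (λ {b} _ → toℕ<n b)
    q<x = after-q (nbhd-self h′ x)
    s≤x = ℕₚ.≤-trans s≤q (ℕₚ.<⇒≤ q<x)
    link : C x * (segment (toℕ s) q * square (segment (toℕ s) (toℕ x)))
         ≤ A x * (segment (toℕ s) (toℕ x) * square (segment (toℕ s) (headPos n ys)))
    link = link-≤ (B-nonNeg x) (segment-nonNeg _ _) (segment-nonNeg _ _)
      (weight-+-segment-≤ʳ (inNbhd? h′ x) (ℕₚ.<⇒≤ (ℕₚ.<-trans q<x (before-next (nbhd-self h′ x))))
        (λ nb → (ℕₚ.≤-trans s≤q (ℕₚ.<⇒≤ (after-q nb)) , ℕₚ.<⇒≤ (before-next nb)) , after-q nb))
      (segment≤A-right sx s≤x)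

  left-bound : ∀ Ll → AllPairs Fin._<_ Ll → All (Fin._< s) Ll → All Stair Ll →
    Π C Ll * cube (w s) ≤ Π A Ll * cube T
  left-bound Ll sorted Ll<s stair = ℚₚ.≤-trans
    (left-chain Ll ℕ.z≤n sorted Ll<s stair (headNbhd′From-zero Ll))
    (*-monoˡ-≤ (Π A Ll) (Π-nonNeg A-nonNeg Ll) (segments≤cube-T _ _ _ _))

  centre-bound : C s * w s ≤ A s * T
  centre-bound = ℚₚ.≤-trans
    (*-mono-≤ (C-nonNeg s) (w≥0 s) (*-monoˡ-≤ twoℚ 0≤2 (weight≤sum (inNbhd? h′ s) (allFin n)))
      (weight-∈ (inNbhd? h s) (allFin n) (∈-allFin s) (nbhd-self h s)))
    (ℚₚ.≤-reflexive (ℚₚ.*-comm T (A s)))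

  right-bound : ∀ Lr → AllPairs Fin._<_ Lr → All (s Fin.<_) Lr → All Stair Lr →
    Π C Lr * cube (w s) ≤ Π A Lr * cube T
  right-bound Lr sorted s<Lr stair = ℚₚ.≤-trans
    (*-monoˡ-≤ (Π C Lr) (Π-nonNeg C-nonNeg Lr)
      (*-mono-≤ (w≥0 s) (*-nonNeg (w≥0 s) (w≥0 s)) (w≤segment s ℕₚ.≤-refl ℕₚ.≤-refl)
        (square-mono-≤ (w≥0 s) (w≤segment s ℕₚ.≤-refl (ℕₚ.<⇒≤ s<next)))))
    (right-chain Lr ℕₚ.≤-refl sorted stair (headNbhd′From-next Lr (stair-self h s) stair s<Lr))
    where
    s<next = nbhd′-before-next Lr (stair-self h s) stair s<Lr (λ {b} _ → toℕ<n b) (nbhd-self h′ s)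

  seven-split : ∀ p → p * (p * (p * (p * (p * (p * (p * 1ℚ)))))) ≡ (p * (p * p)) * (p * (p * (p * p)))
  seven-split = solve-∀ ℚ-ring

  stair-bound : ∀ Ll Lr → AllPairs Fin._<_ (Ll ++ s ∷ Lr) → All Stair (Ll ++ s ∷ Lr) →
    Π C (Ll ++ s ∷ Lr) * w s ^ℚ 7 ≤ Π A (Ll ++ s ∷ Lr) * T ^ℚ 7
  stair-bound Ll Lr sorted stair = begin
    Π C (Ll ++ s ∷ Lr) * w s ^ℚ 7     ≡⟨ cong₂ _*_ (Π-++ C Ll (s ∷ Lr)) (seven-split (w s)) ⟩
    (Π C Ll * (C s * Π C Lr)) * (cube (w s) * (w s * cube (w s)))
                                      ≡⟨ regroup (Π C Ll) (C s) (Π C Lr) (cube (w s)) (w s) (cube (w s)) ⟩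
    (Π C Ll * cube (w s)) * ((C s * w s) * (Π C Lr * cube (w s)))
                                      ≤⟨ *-mono-≤ 0≤left (*-nonNeg 0≤centre 0≤right)
                                           (left-bound Ll Ll-sorted Ll<s (Allₚ.++⁻ˡ Ll stair))
                                           (*-mono-≤ 0≤centre 0≤right centre-bound
                                              (right-bound Lr Lr-sorted s<Lr Lr-stair)) ⟩
    (Π A Ll * cube T) * ((A s * T) * (Π A Lr * cube T))
                                      ≡⟨ regroup (Π A Ll) (A s) (Π A Lr) (cube T) T (cube T) ⟨
    (Π A Ll * (A s * Π A Lr)) * (cube T * (T * cube T))
                                      ≡⟨ cong₂ _*_ (Π-++ A Ll (s ∷ Lr)) (seven-split T) ⟨
    Π A (Ll ++ s ∷ Lr) * T ^ℚ 7       ∎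
    where
    open ℚₚ.≤-Reasoning
    split = AllPairs-++⁻ Ll sorted
    Ll-sorted = proj₁ split
    Ll<s = All.map All.head (proj₁ (proj₂ split))
    s<Lr = AllPairs.head (proj₂ (proj₂ split))
    Lr-sorted = AllPairs.tail (proj₂ (proj₂ split))
    Lr-stair = All.tail (Allₚ.++⁻ʳ Ll stair)
    0≤ws³ = *-nonNeg (w≥0 s) (*-nonNeg (w≥0 s) (w≥0 s))
    0≤left = *-nonNeg (Π-nonNeg C-nonNeg Ll) 0≤ws³
    0≤centre = *-nonNeg (C-nonNeg s) (w≥0 s)
    0≤right = *-nonNeg (Π-nonNeg C-nonNeg Lr) 0≤ws³
    regroup : ∀ a b c x y z → (a * (b * c)) * (x * (y * z)) ≡ (a * x) * ((b * y) * (c * z))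
    regroup = solve-∀ ℚ-ring

  stairs : List (Fin n)
  stairs = stair h s

  stairs-bound : Π C stairs * w s ^ℚ 7 ≤ Π A stairs * T ^ℚ 7
  stairs-bound with Ll , Lr , stairs≡ ← ∈-∃++ (∈-filter⁺ (inStair? h s) (∈-allFin s) (stair-self h s)) =
    subst (λ L → Π C L * w s ^ℚ 7 ≤ Π A L * T ^ℚ 7) (sym stairs≡)
      (stair-bound Ll Lr (subst (AllPairs Fin._<_) stairs≡ sorted)
                         (subst (All Stair) stairs≡ (Allₚ.all-filter (inStair? h s) (allFin n))))
    where
    sorted : AllPairs Fin._<_ stairs
    sorted = AllPairsₚ.filter⁺ (inStair? h s) (AllPairsₚ.tabulate⁺-< id)

  off-stairs : List (Fin n)
  off-stairs = filter (∁? (inStair? h s)) (allFin n)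

  off-stairs-bound : Π B off-stairs ≤ Π A off-stairs
  off-stairs-bound = Π-mono B-nonNeg (All.map
    (λ ¬sx → weight-mono (inNbhd? h′ _) (inNbhd? h _) (nbhd′⊆nbhd ¬sx) (allFin n))
    (Allₚ.all-filter (∁? (inStair? h s)) (allFin n)))

  doubled-potential : twoℚ ^ℚ length stairs * Π B (allFin n) ≡ Π C stairs * Π B off-stairs
  doubled-potential = begin
    twoℚ ^ℚ length stairs * Π B (allFin n)
      ≡⟨ cong (twoℚ ^ℚ length stairs *_) (Π-partition (inStair? h s) B (allFin n)) ⟩
    twoℚ ^ℚ length stairs * (Π B stairs * Π B off-stairs)
      ≡⟨ ℚₚ.*-assoc (twoℚ ^ℚ length stairs) (Π B stairs) (Π B off-stairs) ⟨
    twoℚ ^ℚ length stairs * Π B stairs * Π B off-stairs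
      ≡⟨ cong (_* Π B off-stairs) (Π-scale twoℚ B stairs) ⟩
    Π C stairs * Π B off-stairs
      ∎
    where open ≡-Reasoning

  potential-bound : twoℚ ^ℚ length stairs * expPotential h′ w * w s ^ℚ 7 ≤ expPotential h w * T ^ℚ 7
  potential-bound = begin
    twoℚ ^ℚ length stairs * Π B (allFin n) * w s ^ℚ 7
      ≡⟨ cong (_* w s ^ℚ 7) doubled-potential ⟩
    Π C stairs * Π B off-stairs * w s ^ℚ 7
      ≡⟨ xy∙z≈xz∙y (Π C stairs) (Π B off-stairs) (w s ^ℚ 7) ⟩
    Π C stairs * w s ^ℚ 7 * Π B off-stairs
      ≤⟨ *-mono-≤ (*-nonNeg (Π-nonNeg C-nonNeg stairs) (^ℚ-nonNeg (w≥0 s) 7))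
           (Π-nonNeg B-nonNeg off-stairs)
           stairs-bound off-stairs-bound ⟩
    Π A stairs * T ^ℚ 7 * Π A off-stairs
      ≡⟨ xy∙z≈xz∙y (Π A stairs) (T ^ℚ 7) (Π A off-stairs) ⟩
    Π A stairs * Π A off-stairs * T ^ℚ 7
      ≡⟨ cong (_* T ^ℚ 7) (Π-partition (inStair? h s) A (allFin n)) ⟨
    Π A (allFin n) * T ^ℚ 7
      ∎
    where open ℚₚ.≤-Reasoning

theorem6 : ∃[ c ] ((n : ℕ) (h : Fin n → ℕ) (w : Fin n → ℚ) → (∀ i → 0ℚ < w i) →
    (s : Fin n) (h' : Fin n → ℕ) → GreedyStep h s h' →
    (twoℚ ^ℚ length (stair h s)) * expPotential h' w * (w s ^ℚ c)
      ≤ expPotential h w * ((twoℚ * totalWeight w) ^ℚ c))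
theorem6 = 7 , λ n h w w>0 s h′ greedy →
  AccessBound.potential-bound greedy w (λ i → ℚₚ.<⇒≤ (w>0 i))
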